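{- Define for $k\ge 0$ the one-dimensional words $u_k=(10^{2^k-1})^\omega$ and $u_{ -1}=10^\omega$. For $n\ge1$ let $k(n)$ be the unique $k\ge0$ with $n\equiv 2^k\pmod{2^{k+1}}$, and let $k(0)=-1$. Define $w\colon\mathbb{N}^2\to\{0,1\}$ by $w(i,n)=u_{k(n)}(i)$ (so the $n$-th row is $u_{k(n)}$). Then $w$ is uniformly recurrent (UR), but its row $(w(i,0))_{i\in\mathbb{N}}$ is not recurrent.
   Context: $\mathbb{N}=\{0,1,\ldots\}$; one-dimensional words are indexed from $0$. A one-dimensional word is recurrent if each of its prefixes occurs in it at least twice. For a bidimensional word $w\colon\mathbb{N}^2\to A$, a finite word $f$ of size $(s_1,s_2)$ is a factor occurring at position $\mathbf{p}$ if $f(\mathbf{i})=w(\mathbf{p}+\mathbf{i})$ for all $\mathbf{i}\in\{0,\ldots,s_1-1\}\times\{0,\ldots,s_2-1\}$; a prefix if $\mathbf{p}=(0,0)$. $w$ is UR if for every prefix $p$ there exists $b\ge 1$ such that every factor of $w$ of size $(b,b)$ contains $p$ as a factor. -}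

module Defs where

open import Data.Nat using (ℕ; zero; suc; _+_; _^_; _≤_; _<_; _≟_)
open import Data.Nat.DivMod using (_%_)
open import Data.Nat.Properties using (m^n≢0)
open import Data.Fin using (Fin)
open import Data.Maybe using (Maybe; just; nothing)
open import Data.Product using (Σ; ∃; _×_)
open import Relation.Binary.PropositionalEquality using (_≡_)
open import Relation.Nullary using (yes; no)

Word : Set → Set
Word A = ℕ → A

-- Bidimensional words: w i n  is  w(i,n).
Word2 : Set → Set
Word2 A = ℕ → ℕ → A

Recurrent : {A : Set} → Word A → Set
Recurrent x = ∀ (n : ℕ) → ∃ λ p → (1 ≤ p) × (∀ j → j < n → x (p + j) ≡ x j)

OccursAt : {A : Set} → Word2 A → ℕ → ℕ → ℕ → ℕ → Set
OccursAt w s₁ s₂ r₁ r₂ =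
  ∀ i j → i < s₁ → j < s₂ → w (r₁ + i) (r₂ + j) ≡ w i j

UR : {A : Set} → Word2 A → Set
UR w = ∀ (s₁ s₂ : ℕ) → ∃ λ b → (1 ≤ b) ×
  (∀ (q₁ q₂ : ℕ) → ∃ λ r₁ → ∃ λ r₂ →
     (r₁ + s₁ ≤ b) × (r₂ + s₂ ≤ b) × OccursAt w s₁ s₂ (q₁ + r₁) (q₂ + r₂))

-- Alphabet {0,1} as Fin 2.
-- u k = (1 0^(2^k - 1))^ω :  u k i = 1 iff i ≡ 0 mod 2^k.
u : ℕ → Word (Fin 2)
u k i with (i % (2 ^ k)) {{m^n≢0 2 k}} ≟ 0
... | yes _ = Fin.suc Fin.zero
... | no  _ = Fin.zero

uMinus1 : Word (Fin 2)
uMinus1 zero    = Fin.suc Fin.zero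
uMinus1 (suc _) = Fin.zero

-- Index k(n); the value -1 is represented by `nothing`, k ≥ 0 by `just k`.
-- For n ≥ 1, k(n) is the (unique) k with n ≡ 2^k (mod 2^(k+1)); such k
-- satisfies 2^k ≤ n, hence k < n, so searching k = 0,1,…,n-1 suffices.
search : ℕ → ℕ → ℕ → Maybe ℕ
search n k zero = nothing
search n k (suc fuel) with (n % (2 ^ suc k)) {{m^n≢0 2 (suc k)}} ≟ 2 ^ k
... | yes _ = just k
... | no  _ = search n (suc k) fuel

kOf : ℕ → Maybe ℕ
kOf zero    = nothing
kOf (suc m) = search (suc m) 0 (suc m)

uIdx : Maybe ℕ → Word (Fin 2)
uIdx nothing  = uMinus1
uIdx (just k) = u k

w : Word2 (Fin 2)
w i n = uIdx (kOf n) i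

-- Row n of w is u_{v₂(n)}, with v₂ the 2-adic valuation (row 0 is u_{-1}).
-- Fix K with the prefix inside the 2^K × 2^K square.  A row n with v₂(n) = K
-- carries u_K, which agrees with row 0 on its first 2^K letters, and for
-- 0 < j < 2^K we have v₂(n + j) = v₂(j) < K, so row n + j is row j.  All these
-- rows are 2^K-periodic, hence the prefix occurs at (c 2^K, n) for every c, and
-- such positions lie in every square of side 2^(K+2).  Row 0 is 10^ω, whose
-- prefix 1 never reoccurs.
module Submission where

open import Defs
open import Data.Maybe using (just)
open import Data.Nat
  using (ℕ; zero; suc; _+_; _*_; _∸_; _^_; _≤_; _<_; z≤n; s≤s; z<s; _≟_; NonZero; >-nonZero; ≢-nonZero⁻¹)
open import Data.Nat.Divisibility
  using (_∣_; divides; ∣-trans; n∣m*n; *-monoʳ-∣; m%n≡0⇒n∣m; n∣m⇒m%n≡0; ∣⇒≤)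
open import Data.Nat.DivMod
open import Data.Nat.Induction using (<-rec)
open import Data.Nat.Properties
open import Data.Product using (_×_; _,_; ∃; ∃₂; proj₁; proj₂)
open import Relation.Binary.PropositionalEquality
open import Relation.Nullary using (¬_; yes; no; contradiction)

n<2^n : ∀ n → n < 2 ^ n
n<2^n zero    = z<s
n<2^n (suc n) = +-mono-≤ (m^n>0 2 n) (≤-trans (n<2^n n) (m≤m+n (2 ^ n) 0))

^-monoʳ-∣ : ∀ m {a b} → a ≤ b → m ^ a ∣ m ^ b
^-monoʳ-∣ m {b = b} z≤n = divides (m ^ b) (sym (*-identityʳ (m ^ b)))
^-monoʳ-∣ m (s≤s a≤b)   = *-monoʳ-∣ m (^-monoʳ-∣ m a≤b)

round-up : ∀ m .{{_ : NonZero m}} q → ∃₂ λ c r → r ≤ m × q + r ≡ c * m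
round-up m q = suc a , m ∸ t , m∸n≤m m t , (begin
  q + (m ∸ t)           ≡⟨ cong (_+ (m ∸ t)) (m≡m%n+[m/n]*n q m) ⟩
  t + a * m + (m ∸ t)   ≡⟨ cong (_+ (m ∸ t)) (+-comm t (a * m)) ⟩
  a * m + t + (m ∸ t)   ≡⟨ +-assoc (a * m) t (m ∸ t) ⟩
  a * m + (t + (m ∸ t)) ≡⟨ cong (a * m +_) (m+[n∸m]≡n (m%n≤n q m)) ⟩
  a * m + m             ≡⟨ +-comm (a * m) m ⟩
  suc a * m             ∎)
  where
  open ≡-Reasoning
  t = q % m
  a = q / m

Val₂ : ℕ → ℕ → Set
Val₂ n k = (n % 2 ^ suc k) {{m^n≢0 2 (suc k)}} ≡ 2 ^ k

module _ {n k : ℕ} (v : Val₂ n k) where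

  Val₂⇒2^k≤n : 2 ^ k ≤ n
  Val₂⇒2^k≤n = subst (_≤ n) v (m%n≤m n (2 ^ suc k) {{m^n≢0 2 (suc k)}})

  Val₂⇒k<n : k < n
  Val₂⇒k<n = <-≤-trans (n<2^n k) Val₂⇒2^k≤n

  Val₂⇒2^k∣n : 2 ^ k ∣ n
  Val₂⇒2^k∣n = m%n≡0⇒n∣m n (2 ^ k) (begin
    n % 2 ^ k               ≡⟨ m∣n⇒o%n%m≡o%m (2 ^ k) (2 ^ suc k) n (^-monoʳ-∣ 2 (n≤1+n k)) ⟨
    n % 2 ^ suc k % 2 ^ k   ≡⟨ cong (_% 2 ^ k) v ⟩
    2 ^ k % 2 ^ k           ≡⟨ n%n≡0 (2 ^ k) ⟩
    0                       ∎)
    where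
    open ≡-Reasoning
    instance
      _ = m^n≢0 2 k
      _ = m^n≢0 2 (suc k)

  Val₂-+ˡ : ∀ {m} → 2 ^ suc k ∣ m → Val₂ (m + n) k
  Val₂-+ˡ d∣m = trans (%-remove-+ˡ n {{m^n≢0 2 (suc k)}} d∣m) v

Val₂-unique : ∀ {n k k′} → Val₂ n k → Val₂ n k′ → k ≡ k′
Val₂-unique {n} v v′ =
  ≤-antisym (≮⇒≥ λ k′<k → not-below v k′<k v′) (≮⇒≥ λ k<k′ → not-below v′ k<k′ v)
  where
  not-below : ∀ {a b} → Val₂ n a → b < a → ¬ Val₂ n b
  not-below {a} {b} va b<a vb = ≢-nonZero⁻¹ (2 ^ b) (begin
    2 ^ b          ≡⟨ vb ⟨
    n % 2 ^ suc b  ≡⟨ n∣m⇒m%n≡0 n (2 ^ suc b) 2^1+b∣n ⟩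
    0              ∎)
    where
    open ≡-Reasoning
    instance
      _ = m^n≢0 2 b
      _ = m^n≢0 2 (suc b)
    2^1+b∣n : 2 ^ suc b ∣ n
    2^1+b∣n = ∣-trans (^-monoʳ-∣ 2 b<a) (Val₂⇒2^k∣n {n} {a} va)

Val₂-odd-multiple : ∀ c k → Val₂ (c * 2 ^ suc k + 2 ^ k) k
Val₂-odd-multiple c k = trans (%-remove-+ˡ (2 ^ k) (n∣m*n c))
  (m<n⇒m%n≡m (^-monoʳ-< 2 (s≤s (s≤s z≤n)) (n<1+n k)))
  where instance _ = m^n≢0 2 (suc k)

Val₂-double : ∀ {n k} → Val₂ n k → Val₂ (n * 2) (suc k)
Val₂-double {n} {k} v = begin
  n * 2 % 2 ^ suc (suc k)  ≡⟨ %-congʳ (*-comm 2 (2 ^ suc k)) ⟩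
  n * 2 % (2 ^ suc k * 2)  ≡⟨ m%n*o≡m*o%[n*o] n (2 ^ suc k) 2 ⟨
  n % 2 ^ suc k * 2        ≡⟨ cong (_* 2) v ⟩
  2 ^ k * 2                ≡⟨ *-comm (2 ^ k) 2 ⟩
  2 ^ suc k                ∎
  where
  open ≡-Reasoning
  instance
    _ = m^n≢0 2 (suc k)
    _ = m^n≢0 2 (suc (suc k))
    _ = m*n≢0 (2 ^ suc k) 2

Val₂-exists : ∀ n → 0 < n → ∃ (Val₂ n)
Val₂-exists = <-rec (λ n → 0 < n → ∃ (Val₂ n)) step
  where
  step : ∀ n → (∀ {m} → m < n → 0 < m → ∃ (Val₂ m)) → 0 < n → ∃ (Val₂ n)
  step n rec 0<n with n % 2 in parity
  ... | 1           = 0 , parity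
  ... | suc (suc _) = contradiction (subst (_< 2) parity (m%n<n n 2)) λ { (s≤s (s≤s ())) }
  ... | 0           =
    suc k , subst (λ m → Val₂ m (suc k)) (m/n*n≡m 2∣n) (Val₂-double {n / 2} {k} v)
    where
    instance _ = >-nonZero 0<n
    2∣n : 2 ∣ n
    2∣n = m%n≡0⇒n∣m n 2 parity
    half-val : ∃ (Val₂ (n / 2))
    half-val = rec (m/n<m n 2 (s≤s (s≤s z≤n))) (m≥n⇒m/n>0 (∣⇒≤ 2∣n))
    k = proj₁ half-val
    v = proj₂ half-val

search-complete : ∀ {n k} s f → Val₂ n k → s ≤ k → k < s + f → search n s f ≡ just k
search-complete {k = k} s zero v s≤k k<s+0 =
  contradiction s≤k (<⇒≱ (subst (k <_) (+-identityʳ s) k<s+0))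
search-complete {n} {k} s (suc f) v s≤k k<s+f
  with (n % (2 ^ suc s)) {{m^n≢0 2 (suc s)}} ≟ 2 ^ s
... | yes v′ = cong just (Val₂-unique {n} {s} {k} v′ v)
... | no ¬v′ = search-complete (suc s) f v (≤∧≢⇒< s≤k λ { refl → ¬v′ v })
                               (subst (k <_) (+-suc s f) k<s+f)

kOf-complete : ∀ {n k} → Val₂ n k → kOf n ≡ just k
kOf-complete {zero}  {k} v = contradiction (Val₂⇒k<n {0} {k} v) λ ()
kOf-complete {suc m} {k} v = search-complete 0 (suc m) v z≤n (Val₂⇒k<n {suc m} {k} v)

u-cong : ∀ k {i i′} → (i % 2 ^ k) {{m^n≢0 2 k}} ≡ (i′ % 2 ^ k) {{m^n≢0 2 k}} → u k i ≡ u k i′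
u-cong k {i} {i′} eq with (i % 2 ^ k) {{m^n≢0 2 k}} ≟ 0 | (i′ % 2 ^ k) {{m^n≢0 2 k}} ≟ 0
... | yes _  | yes _  = refl
... | no _   | no _   = refl
... | yes i≡0 | no i′≢0 = contradiction (trans (sym eq) i≡0) i′≢0
... | no i≢0 | yes i′≡0 = contradiction (trans eq i′≡0) i≢0

u-periodic : ∀ {k K} c i → k ≤ K → u k (c * 2 ^ K + i) ≡ u k i
u-periodic {k} {K} c i k≤K =
  u-cong k (%-remove-+ˡ i {{m^n≢0 2 k}} (∣-trans (^-monoʳ-∣ 2 k≤K) (n∣m*n c)))

u≡uMinus1 : ∀ k {i} → i < 2 ^ k → u k i ≡ uMinus1 i
u≡uMinus1 k {zero} i<2^k with (0 % 2 ^ k) {{m^n≢0 2 k}} ≟ 0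
... | yes _ = refl
... | no 0%2^k≢0 = contradiction (m<n⇒m%n≡m {{m^n≢0 2 k}} i<2^k) 0%2^k≢0
u≡uMinus1 k {suc i} i<2^k with (suc i % 2 ^ k) {{m^n≢0 2 k}} ≟ 0
... | no _ = refl
... | yes 1+i%2^k≡0 =
  contradiction (trans (sym (m<n⇒m%n≡m {{m^n≢0 2 k}} i<2^k)) 1+i%2^k≡0) λ ()

w-row : ∀ n {k} i → Val₂ n k → w i n ≡ u k i
w-row n {k} i v = cong (λ m → uIdx m i) (kOf-complete {n} {k} v)

w-occurs : ∀ {N K} c {i j} → Val₂ N K → i < 2 ^ K → j < 2 ^ K →
           w (c * 2 ^ K + i) (N + j) ≡ w i j
w-occurs {N} {K} c {i} {zero} vN i<2^K _ = begin
  w (c * 2 ^ K + i) (N + 0)  ≡⟨ cong (w (c * 2 ^ K + i)) (+-identityʳ N) ⟩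
  w (c * 2 ^ K + i) N        ≡⟨ w-row N _ vN ⟩
  u K (c * 2 ^ K + i)        ≡⟨ u-periodic c i ≤-refl ⟩
  u K i                      ≡⟨ u≡uMinus1 K i<2^K ⟩
  uMinus1 i                  ∎
  where open ≡-Reasoning
w-occurs {N} {K} c {i} {suc j} vN _ j<2^K with Val₂-exists (suc j) z<s
... | k , vj = begin
  w (c * 2 ^ K + i) (N + suc j)  ≡⟨ w-row (N + suc j) _ (Val₂-+ˡ {suc j} {k} vj 2^1+k∣N) ⟩
  u k (c * 2 ^ K + i)            ≡⟨ u-periodic c i (<⇒≤ k<K) ⟩
  u k i                          ≡⟨ w-row (suc j) i vj ⟨
  w i (suc j)                    ∎
  where
  open ≡-Reasoning
  k<K : k < K
  k<K = ≰⇒> λ K≤k → <⇒≱ j<2^K (≤-trans (^-monoʳ-≤ 2 K≤k) (Val₂⇒2^k≤n {suc j} {k} vj))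
  2^1+k∣N : 2 ^ suc k ∣ N
  2^1+k∣N = ∣-trans (^-monoʳ-∣ 2 k<K) (Val₂⇒2^k∣n {N} {K} vN)

w-UR : UR w
w-UR s₁ s₂ = D + M + M , ≤-trans (m^n>0 2 K) (m≤n+m M (D + M)) , window
  where
  K = s₁ + s₂
  M = 2 ^ K
  D = 2 ^ suc K
  s₁<M : s₁ < M
  s₁<M = ≤-<-trans (m≤m+n s₁ s₂) (n<2^n K)
  s₂<M : s₂ < M
  s₂<M = ≤-<-trans (m≤n+m s₂ s₁) (n<2^n K)
  window : ∀ q₁ q₂ → ∃₂ λ r₁ r₂ → r₁ + s₁ ≤ D + M + M × r₂ + s₂ ≤ D + M + M ×
                                 OccursAt w s₁ s₂ (q₁ + r₁) (q₂ + r₂)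
  window q₁ q₂ with round-up M {{m^n≢0 2 K}} q₁ | round-up D {{m^n≢0 2 (suc K)}} q₂
  ... | c₁ , r₁ , r₁≤M , column | c₂ , r₂ , r₂≤D , row =
    r₁ , r₂ + M ,
    ≤-trans (+-mono-≤ r₁≤M (<⇒≤ s₁<M)) (+-monoˡ-≤ M (m≤n+m M D)) ,
    +-mono-≤ (+-monoˡ-≤ M r₂≤D) (<⇒≤ s₂<M) ,
    λ i j i<s₁ j<s₂ → subst₂ (λ x y → w (x + i) (y + j) ≡ w i j) (sym column) (sym row′)
      (w-occurs {c₂ * D + M} {K} c₁ (Val₂-odd-multiple c₂ K)
                (<-trans i<s₁ s₁<M) (<-trans j<s₂ s₂<M))
    where
    row′ : q₂ + (r₂ + M) ≡ c₂ * D + M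
    row′ = trans (sym (+-assoc q₂ r₂ M)) (cong (_+ M) row)

uMinus1-not-recurrent : ¬ Recurrent uMinus1
uMinus1-not-recurrent recurrent with recurrent 1
... | suc p , _ , agrees with agrees 0 z<s
... | ()

proposition2p5 : UR w × ¬ Recurrent (λ i → w i 0)
proposition2p5 = w-UR , uMinus1-not-recurrent
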